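{- Let $\mathcal{I}=(R,U,C,\omega)$ be an instance of Valued APEP such that $C$ is $t$-wbounded. Then $\mathcal{I}$ has an optimal solution $A^*$ with $|A^*|\le t$.
   Context: $U$ is a finite set of users and $R$ a finite set of resources. An authorization relation is $A\subseteq U\times R$, with $A(r)=\{u:(u,r)\in A\}$, $A(u)=\{r:(u,r)\in A\}$; $A$ is complete if $A(r)\ne\emptyset$ for all $r\in R$. A weighted constraint is a function $w_c:2^{U\times R}\to\mathbb{N}$ ($w_c(A)=0$ iff $A$ satisfies the constraint). A weighted user authorization function is $\omega:U\times 2^R\to\mathbb{N}$ with $\omega(u,T)=0$ if $u$ is authorized for every resource of $T$ and $\omega(u,T')\le\omega(u,T)$ whenever $T'\subseteq T$. Define $\Omega(A)=\sum_{u\in U}\omega(u,A(u))$, $w_C(A)=\sum_{c\in C}w_c(A)$, $w(A)=\Omega(A)+w_C(A)$. An instance of Valued APEP is $(R,U,C,\omega)$; a solution is a complete authorization relation and an optimal solution is a complete authorization relation of minimum weight $w$. A set $C$ of weighted constraints is $t$-wbounded if for every complete authorization relation $A$ with $|A|>t$ there exists a complete authorization relation $A'\subseteq A$ with $|A'|<|A|$ and $w_C(A')\le w_C(A)$. -}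

module Defs where

open import Data.Nat using (ℕ; _+_; _≤_; _<_)
open import Data.Fin using (Fin)
open import Data.Fin.Subset using (Subset; _∈_; _⊆_; ∣_∣)
open import Data.Vec using (Vec; lookup; tabulate)
import Data.Vec as Vec
open import Data.List using (List)
open import Data.Nat.ListAction renaming (sum to sumL)
import Data.List as List
open import Data.Product using (∃; Σ; _×_)
open import Relation.Binary.PropositionalEquality using (_≡_)

-- Users are Fin m, resources are Fin n.
-- An authorization relation A ⊆ U × R is represented by the vector of the
-- sets A(u) = {r : (u,r) ∈ A}, one per user u.
AuthRel : ℕ → ℕ → Set
AuthRel m n = Vec (Subset n) m

_⟨_⟩ : ∀ {m n} → AuthRel m n → Fin m → Subset n
A ⟨ u ⟩ = lookup A u

_⊆ᴬ_ : ∀ {m n} → AuthRel m n → AuthRel m n → Set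
A' ⊆ᴬ A = ∀ u → (A' ⟨ u ⟩) ⊆ (A ⟨ u ⟩)

size : ∀ {m n} → AuthRel m n → ℕ
size A = Vec.sum (Vec.map ∣_∣ A)

Complete : ∀ {m n} → AuthRel m n → Set
Complete {m} {n} A = (r : Fin n) → ∃ λ (u : Fin m) → r ∈ A ⟨ u ⟩

WConstraint : ℕ → ℕ → Set
WConstraint m n = AuthRel m n → ℕ

wC : ∀ {m n} → List (WConstraint m n) → AuthRel m n → ℕ
wC C A = sumL (List.map (λ c → c A) C)

-- weighted user authorization function ω : U × 2^R → ℕ, relative to the
-- (given) user authorization policy `auth` (auth ⟨ u ⟩ = resources u is authorized for)
record WUserAuth (m n : ℕ) (auth : AuthRel m n) : Set where
  field
    ω        : Fin m → Subset n → ℕ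
    ω-zero   : ∀ u T → T ⊆ (auth ⟨ u ⟩) → ω u T ≡ 0
    ω-mono   : ∀ u T' T → T' ⊆ T → ω u T' ≤ ω u T

Ω : ∀ {m n} {auth : AuthRel m n} → WUserAuth m n auth → AuthRel m n → ℕ
Ω {m} W A = Vec.sum (tabulate {n = m} λ u → WUserAuth.ω W u (A ⟨ u ⟩))

weight : ∀ {m n} {auth : AuthRel m n} → WUserAuth m n auth →
         List (WConstraint m n) → AuthRel m n → ℕ
weight W C A = Ω W A + wC C A

WBounded : ∀ {m n} → ℕ → List (WConstraint m n) → Set
WBounded {m} {n} t C =
  (A : AuthRel m n) → Complete A → t < size A →
  Σ (AuthRel m n) λ A' → Complete A' × A' ⊆ᴬ A × size A' < size A × wC C A' ≤ wC C A

Optimal : ∀ {m n} {auth : AuthRel m n} → WUserAuth m n auth →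
          List (WConstraint m n) → AuthRel m n → Set
Optimal {m} {n} W C A* =
  Complete A* × ((A : AuthRel m n) → Complete A → weight W C A* ≤ weight W C A)

-- Weight is minimised over the finitely many complete relations. Shrinking
-- a relation never increases Ω, since each ω(u, ·) is monotone, and by
-- t-wboundedness a complete relation larger than t can be shrunk without
-- increasing w_C; so an optimal relation larger than t can be replaced by a
-- strictly smaller one that is still optimal, and this descent on |A| ends
-- at an optimal relation of size at most t.
module Submission where

open import Defs
open import Data.Nat using (ℕ; _≤_; _<_; zero; suc)
open import Data.Nat.Properties using (_<?_; ≮⇒≥; ≤-trans; +-mono-≤; ≤-refl)
open import Data.Nat.Induction using (<-wellFounded)
open import Induction.WellFounded using (Acc; acc)
open import Data.List using (List)
open import Data.Product using (Σ; ∃; _×_; _,_)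
open import Data.Vec using (Vec; []; _∷_; tabulate)
import Data.Vec as Vec
open import Data.Fin using (Fin)
open import Data.Fin.Subset.Properties using (anySubset?; _∈?_)
import Data.Fin.Properties as Fin
open import Relation.Nullary using (Dec; yes; no)
open import Relation.Nullary.Decidable using (_×-dec_)
open import Relation.Unary using (Decidable)

Searchable : Set → Set₁
Searchable X = {P : X → Set} → Decidable P → Dec (∃ P)

searchable-Vec : ∀ {X} → Searchable X → ∀ m → Searchable (Vec X m)
searchable-Vec search zero P? with P? []
... | yes p = yes ([] , p)
... | no ¬p = no λ { ([] , p) → ¬p p }
searchable-Vec search (suc m) P? with search (λ x → searchable-Vec search m (λ xs → P? (x ∷ xs)))
... | yes (x , xs , p) = yes (x ∷ xs , p)
... | no ¬p = no λ { (x ∷ xs , p) → ¬p (x , xs , p) }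

∃-minimum : ∀ {X} → Searchable X → {P : X → Set} → Decidable P → (f : X → ℕ) →
            ∃ P → Σ X λ x → P x × (∀ y → P y → f x ≤ f y)
∃-minimum {X} search {P} P? f (x₀ , p₀) = descend x₀ p₀ (<-wellFounded (f x₀))
  where
  descend : ∀ x → P x → Acc _<_ (f x) → Σ X λ x → P x × (∀ y → P y → f x ≤ f y)
  descend x p (acc smaller) with search (λ y → P? y ×-dec (f y <? f x))
  ... | yes (y , q , fy<fx) = descend y q (smaller fy<fx)
  ... | no ¬better = x , p , λ y q → ≮⇒≥ (λ fy<fx → ¬better (y , q , fy<fx))

sum-tabulate-mono-≤ : ∀ m {f g : Fin m → ℕ} → (∀ i → f i ≤ g i) →
                      Vec.sum (tabulate f) ≤ Vec.sum (tabulate g)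
sum-tabulate-mono-≤ zero    f≤g = ≤-refl
sum-tabulate-mono-≤ (suc m) f≤g =
  +-mono-≤ (f≤g Fin.zero) (sum-tabulate-mono-≤ m (λ i → f≤g (Fin.suc i)))

complete? : ∀ {m n} → Decidable (Complete {m} {n})
complete? A = Fin.all? (λ r → Fin.any? (λ u → r ∈? (A ⟨ u ⟩)))

module _ {m n} {auth : AuthRel m n} (W : WUserAuth m n auth) (C : List (WConstraint m n)) where

  Ω-mono-⊆ᴬ : ∀ {A' A} → A' ⊆ᴬ A → Ω W A' ≤ Ω W A
  Ω-mono-⊆ᴬ {A'} {A} A'⊆A =
    sum-tabulate-mono-≤ m (λ u → WUserAuth.ω-mono W u (A' ⟨ u ⟩) (A ⟨ u ⟩) (A'⊆A u))

  weight-mono-⊆ᴬ : ∀ {A' A} → A' ⊆ᴬ A → wC C A' ≤ wC C A → weight W C A' ≤ weight W C A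
  weight-mono-⊆ᴬ {A'} {A} A'⊆A = +-mono-≤ (Ω-mono-⊆ᴬ {A'} {A} A'⊆A)

  optimal-exists : ∃ (Complete {m} {n}) → ∃ (Optimal W C)
  optimal-exists = ∃-minimum (searchable-Vec anySubset? m) complete? (weight W C)

  optimal-within-bound : ∀ {t} → WBounded t C → ∀ {A} → Optimal W C A →
                         Σ (AuthRel m n) λ A* → Optimal W C A* × size A* ≤ t
  optimal-within-bound {t} bounded {A} optimal = shrink A optimal (<-wellFounded (size A))
    where
    shrink : ∀ A → Optimal W C A → Acc _<_ (size A) →
             Σ (AuthRel m n) λ A* → Optimal W C A* × size A* ≤ t
    shrink A optimal _ with t <? size A
    shrink A optimal _ | no t≮size = A , optimal , ≮⇒≥ t≮size
    shrink A (complete , minimal) (acc smaller) | yes t<size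
      with bounded A complete t<size
    ... | A' , complete' , A'⊆A , size< , wC≤ =
          shrink A' (complete' , λ B cB → ≤-trans (weight-mono-⊆ᴬ A'⊆A wC≤) (minimal B cB))
                 (smaller size<)

lemma2 : (m n : ℕ) (auth : AuthRel m n) (W : WUserAuth m n auth)
         (C : List (WConstraint m n)) (t : ℕ) →
         WBounded t C →
         (∃ λ (A : AuthRel m n) → Complete A) →
         Σ (AuthRel m n) λ A* → Optimal W C A* × size A* ≤ t
lemma2 m n auth W C t bounded solution =
  let _ , optimal = optimal-exists W C solution
  in optimal-within-bound W C bounded optimal
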